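{- Let $n>1$ be an integer which is multiplicatively $e$-perfect or multiplicatively $e$-superperfect, and let $p$ be the unique prime dividing $n$ (such $n$ are prime powers $n=p^a$). Then $n$ is $e$-harmonic of type $1$ if and only if $\sigma_e(n)/p$ divides $d_e(n)$.
   Context: For $n=p_1^{a_1}\cdots p_r^{a_r}>1$ (prime factorization), a divisor $d$ of $n$ is an exponential divisor ($e$-divisor) if $d=p_1^{b_1}\cdots p_r^{b_r}$ with $b_i\mid a_i$ for all $i$. $\sigma_e(n)$ is the sum of the $e$-divisors of $n$, $d_e(n)$ is the number of $e$-divisors of $n$ (so $d_e(n)=d(a_1)\cdots d(a_r)$, $d$ the number-of-divisors function), and $T_e(n)$ is the product of the $e$-divisors of $n$. $n$ is multiplicatively $e$-perfect if $T_e(n)=n^2$ and multiplicatively $e$-superperfect if $T_e(T_e(n))=n^2$. It is known (Sándor) that $n>1$ is multiplicatively $e$-perfect iff $n=p^a$ with $p$ prime and $a$ perfect ($\sigma(a)=2a$), and multiplicatively $e$-superperfect iff $n=p^a$ with $p$ prime and $\sigma(\sigma(a))=2a$. $n$ is called $e$-harmonic of type $1$ if $\sigma_e(n)\mid n\,d_e(n)$. -}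

module Defs where

open import Data.Nat using (ℕ; zero; suc; _+_; _*_; _≤?_; _<?_)
open import Data.Nat.DivMod using (_/_)
open import Data.Nat.Divisibility using (_∣?_)
open import Data.Nat.Primality using (prime?)
open import Data.Bool using (Bool; true; false; _∧_; _∨_; not; if_then_else_)
open import Data.List using (List; []; _∷_; length; upTo; map; filter)
open import Data.Nat.ListAction using (sum; product)
open import Relation.Nullary.Decidable using (⌊_⌋)
open import Data.Bool.Properties using (T?)

allB : (ℕ → Bool) → List ℕ → Bool
allB f [] = true
allB f (x ∷ xs) = f x ∧ allB f xs

-- p-adic valuation v_p(m) (number of times p divides m), for p ≥ 2 and m ≥ 1;
-- fuel bounded by m, which suffices since each step divides m by p ≥ 2.
valAux : ℕ → ℕ → ℕ → ℕ
valAux zero    p m = 0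
valAux (suc k) zero m = 0
valAux (suc k) (suc zero) m = 0
valAux (suc k) p@(suc (suc q)) m =
  if ⌊ 1 ≤? m ⌋ ∧ ⌊ p ∣? m ⌋ then suc (valAux k p (m / p)) else 0

val : ℕ → ℕ → ℕ
val p m = valAux m p m

-- d is an exponential divisor of n: d ∣ n and for every prime p dividing n,
-- v_p(d) ∣ v_p(n) (this forces v_p(d) ≥ 1, as 0 ∤ a for a ≥ 1).
-- Primes dividing n are ≤ n, so it suffices to check p ∈ {0,…,n}.
isEDiv : ℕ → ℕ → Bool
isEDiv n d = ⌊ d ∣? n ⌋ ∧
  allB (λ p → not (⌊ prime? p ⌋ ∧ ⌊ p ∣? n ⌋) ∨ ⌊ val p d ∣? val p n ⌋) (upTo (suc n))

eDivisors : ℕ → List ℕ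
eDivisors n = filter (λ d → T? (isEDiv n d)) (map suc (upTo n))

σₑ : ℕ → ℕ
σₑ n = sum (eDivisors n)

dₑ : ℕ → ℕ
dₑ n = length (eDivisors n)

Tₑ : ℕ → ℕ
Tₑ n = product (eDivisors n)

sq : ℕ → ℕ
sq n = n * n

-- Every e-divisor of n is divisible by every prime factor of n. If r² ∣ n for a prime r,
-- lowering the exponent of r to 1 gives a second e-divisor N′ with n = r^(k+1) N′, so
-- Tₑ n = n N′ R where R, the product of the remaining e-divisors, is 1 or divisible by
-- every prime factor of n. Comparing this with Tₑ n = n², or with Tₑ (Tₑ n) = n², shows
-- that n is a power of p. Then every e-divisor other than p is divisible by p², so
-- σₑ n = (1 + c p) p, and σₑ n / p is coprime to n; this gives the equivalence.
module Submission where

open import Data.Nat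
open import Relation.Binary.PropositionalEquality hiding ([_])

open import Data.Bool using (Bool; T; not; _∧_; _∨_)
open import Data.Bool.Properties using (T?; T-∧)
open import Data.List using (List; []; _∷_; _++_; map; upTo)
open import Data.List.Membership.Propositional using (_∈_; _∉_)
open import Data.List.Membership.Propositional.Properties
  using (∈-filter⁺; ∈-filter⁻; ∈-map⁺; ∈-map⁻; ∈-upTo⁺; ∈-∃++)
open import Data.List.Relation.Binary.Permutation.Propositional using (_↭_; ↭-sym; ↭⇒↭ₛ)
open import Data.List.Relation.Binary.Permutation.Propositional.Properties using (∈-resp-↭; shift)
open import Data.List.Relation.Binary.Permutation.Setoid.Properties (setoid ℕ) using (Unique-resp-↭)
open import Data.List.Relation.Unary.All as All using (All; []; _∷_)
open import Data.List.Relation.Unary.Any using (here; there)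
open import Data.List.Relation.Unary.Unique.Propositional using (Unique)
open import Data.List.Relation.Unary.Unique.Propositional.Properties
  using (filter⁺; map⁺; upTo⁺; Unique[x∷xs]⇒x∉xs)
open import Data.Nat.Coprimality using (Coprime; coprime-divisor)
open import Data.Nat.DivMod using (_/_; m*[n/m]≡n; m/n<m; m≥n⇒m/n>0; /-congˡ; m*n/n≡m)
open import Data.Nat.Divisibility
open import Data.Nat.ListAction using (sum; product)
open import Data.Nat.ListAction.Properties using (product-↭; sum-↭; product≢0)
open import Data.Nat.Primality
  using (Prime; prime?; euclidsLemma; prime⇒irreducible; prime⇒nonZero; prime⇒nonTrivial)
open import Data.Nat.Primality.Factorisation using (factorise)
open import Data.Nat.Properties
open import Data.Nat.Solver using (module +-*-Solver)
open import Data.Product using (∃; ∃₂; _×_; _,_; proj₁; proj₂)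
open import Data.Sum using (_⊎_; inj₁; inj₂; [_,_]; [_,_]′)
open import Function.Base using (_∘_)
open import Function.Bundles using (_⇔_; mk⇔; Equivalence)
open import Relation.Nullary using (¬_; yes; no; contradiction)
open import Relation.Nullary.Decidable using (⌊_⌋; toWitness; fromWitness)
open import Relation.Unary using (Decidable)
open import Defs

open +-*-Solver using (solve; _:*_; _:+_; _:=_; con)

-- Prime factors

prime>1 : ∀ {p} → Prime p → 1 < p
prime>1 {p} pp = nonTrivial⇒n>1 p {{prime⇒nonTrivial pp}}

prime∤1 : ∀ {p} → Prime p → ¬ (p ∣ 1)
prime∤1 pp p∣1 = >⇒≢ (prime>1 pp) (∣1⇒≡1 p∣1)

∃primeFactor : ∀ {k} → 1 < k → ∃ λ r → Prime r × r ∣ k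
∃primeFactor {k} 1<k with factorise k {{>-nonZero (<-trans z<s 1<k)}}
... | record { factors = [] ; isFactorisation = k≡1 } = contradiction k≡1 (>⇒≢ 1<k)
... | record { factors = r ∷ rs ; isFactorisation = k≡ ; factorsPrime = pr ∷ _ } =
  r , pr , subst (r ∣_) (sym k≡) (m∣m*n (product rs))

OnlyPrimeFactor : ℕ → ℕ → Set
OnlyPrimeFactor p n = ∀ {q} → Prime q → q ∣ n → q ≡ p

RadicalDivides : ℕ → ℕ → Set
RadicalDivides n m = ∀ {t} → Prime t → t ∣ n → t ∣ m

^-onlyPrimeFactor : ∀ {p} k → Prime p → OnlyPrimeFactor p (p ^ k)
^-onlyPrimeFactor zero    pp pq q∣1 = contradiction q∣1 (prime∤1 pq)
^-onlyPrimeFactor {p} (suc k) pp {q} pq q∣p^k+1 with euclidsLemma p (p ^ k) pq q∣p^k+1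
... | inj₂ q∣p^k = ^-onlyPrimeFactor k pp pq q∣p^k
... | inj₁ q∣p with prime⇒irreducible pp q∣p
...   | inj₁ q≡1 = contradiction q≡1 (>⇒≢ (prime>1 pq))
...   | inj₂ q≡p = q≡p

onlyPrimeFactor-∣ : ∀ {p n k} .{{_ : NonZero n}} → OnlyPrimeFactor p n → k ∣ n → k ≢ 1 →
  p ∣ k
onlyPrimeFactor-∣ {n = n} {zero} _ 0∣n _ = contradiction (0∣⇒≡0 0∣n) (≢-nonZero⁻¹ n)
onlyPrimeFactor-∣ {k = suc zero} _ _ 1≢1 = contradiction refl 1≢1
onlyPrimeFactor-∣ {k = suc (suc k)} only k∣n _ with ∃primeFactor {suc (suc k)} (s≤s (s≤s z≤n))
... | r , pr , r∣k = subst (_∣ suc (suc k)) (only pr (∣-trans r∣k k∣n)) r∣k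

onlyPrimeFactor⇒coprime : ∀ {p n m} .{{_ : NonZero n}} → OnlyPrimeFactor p n → ¬ (p ∣ m) →
  Coprime m n
onlyPrimeFactor⇒coprime only p∤m {i} (i∣m , i∣n) with i ≟ 1
... | yes i≡1 = i≡1
... | no  i≢1 = contradiction (∣-trans (onlyPrimeFactor-∣ only i∣n i≢1) i∣m) p∤m

∣⇒nonZero : ∀ {d n} .{{_ : NonZero n}} → d ∣ n → NonZero d
∣⇒nonZero {zero} {n} 0∣n = contradiction (0∣⇒≡0 0∣n) (≢-nonZero⁻¹ n)
∣⇒nonZero {suc d}    _   = _

∤⇒nonZero : ∀ {p w} → ¬ (p ∣ w) → NonZero w
∤⇒nonZero {p} {zero}  p∤0 = contradiction (p ∣0) p∤0
∤⇒nonZero {p} {suc w} _   = _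

-- p-adic valuations

valAux-decomposition : ∀ k q m .{{_ : NonZero m}} → m ≤ k →
  ∃ λ w → m ≡ (2 + q) ^ valAux k (2 + q) m * w × ¬ (2 + q ∣ w)
valAux-decomposition zero q (suc m) ()
valAux-decomposition (suc k) q m m≤1+k with 1 ≤? m | 2 + q ∣? m
... | no m≯0 | _ = contradiction (>-nonZero⁻¹ m) m≯0
... | yes _ | no p∤m = m , sym (*-identityˡ m) , p∤m
... | yes _ | yes p∣m
  with valAux-decomposition k q (m / (2 + q)) {{>-nonZero (m≥n⇒m/n>0 (∣⇒≤ p∣m))}}
         (<⇒≤pred (<-≤-trans (m/n<m m (2 + q) (s≤s (s≤s z≤n))) m≤1+k))
...   | w , m/p≡ , p∤w = w , m≡ , p∤w
  where
  open ≡-Reasoning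
  p v : ℕ
  p = 2 + q
  v = valAux k p (m / p)
  m≡ : m ≡ p ^ suc v * w
  m≡ = begin
    m               ≡⟨ m*[n/m]≡n p∣m ⟨
    p * (m / p)     ≡⟨ cong (p *_) m/p≡ ⟩
    p * (p ^ v * w) ≡⟨ *-assoc p (p ^ v) w ⟨
    p ^ suc v * w   ∎

valAux-^* : ∀ k q v w → ¬ (2 + q ∣ w) → (2 + q) ^ v * w ≤ k →
  valAux k (2 + q) ((2 + q) ^ v * w) ≡ v
valAux-^* zero q v w p∤w x≤0 =
  contradiction x≤0 (<⇒≱ (>-nonZero⁻¹ _ {{x≢0}}))
  where
  x≢0 : NonZero ((2 + q) ^ v * w)
  x≢0 = m*n≢0 ((2 + q) ^ v) w {{m^n≢0 (2 + q) v}} {{∤⇒nonZero p∤w}}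
valAux-^* (suc k) q zero w p∤w _ with 1 ≤? 1 * w | 2 + q ∣? 1 * w
... | _     | yes p∣w = contradiction (subst (2 + q ∣_) (*-identityˡ w) p∣w) p∤w
... | yes _ | no _    = refl
... | no _  | no _    = refl
valAux-^* (suc k) q (suc v) w p∤w x≤1+k with 1 ≤? x | 2 + q ∣? x
  where
  x : ℕ
  x = (2 + q) ^ suc v * w
... | yes _  | yes _   = cong suc (trans (cong (valAux k p) x/p≡y) (valAux-^* k q v w p∤w y≤k))
  where
  p y : ℕ
  p = 2 + q
  y = p ^ v * w
  instance _ = m*n≢0 (p ^ v) w {{m^n≢0 p v}} {{∤⇒nonZero p∤w}}
  x≡y*p : p ^ suc v * w ≡ y * p
  x≡y*p = trans (*-assoc p (p ^ v) w) (*-comm p y)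
  x/p≡y : p ^ suc v * w / p ≡ y
  x/p≡y = trans (/-congˡ x≡y*p) (m*n/n≡m y p)
  y≤k : y ≤ k
  y≤k = <⇒≤pred (<-≤-trans (subst (y <_) (sym x≡y*p) (m<m*n y p (s≤s (s≤s z≤n)))) x≤1+k)
... | _      | no p∤x  = contradiction (∣m⇒∣m*n w (m∣m*n ((2 + q) ^ v))) p∤x
... | no x≯0 | yes _   =
  contradiction (>-nonZero⁻¹ _ {{x≢0}}) x≯0
  where
  x≢0 : NonZero ((2 + q) ^ suc v * w)
  x≢0 = m*n≢0 ((2 + q) ^ suc v) w {{m^n≢0 (2 + q) (suc v)}} {{∤⇒nonZero p∤w}}

val-decomposition : ∀ {p} m .{{_ : NonZero m}} → 1 < p →
  ∃ λ w → m ≡ p ^ val p m * w × ¬ (p ∣ w)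
val-decomposition {suc (suc q)} m _ = valAux-decomposition m q m ≤-refl
val-decomposition {suc zero}    m (s≤s ())

val-^* : ∀ {p} v w → 1 < p → ¬ (p ∣ w) → val p (p ^ v * w) ≡ v
val-^* {suc (suc q)} v w _ p∤w = valAux-^* _ q v w p∤w ≤-refl
val-^* {suc zero}    v w (s≤s ())

val-*≡1 : ∀ {p} w → 1 < p → ¬ (p ∣ w) → val p (p * w) ≡ 1
val-*≡1 {p} w 1<p p∤w =
  trans (cong (val p) (cong (_* w) (sym (*-identityʳ p)))) (val-^* 1 w 1<p p∤w)

∣⇒val>0 : ∀ {p} m .{{_ : NonZero m}} → 1 < p → p ∣ m → 0 < val p m
∣⇒val>0 {p} m 1<p p∣m with val-decomposition m 1<p
... | w , m≡ , p∤w = helper (val p m) m≡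
  where
  helper : ∀ v → m ≡ p ^ v * w → 0 < v
  helper zero    m≡w = contradiction (subst (p ∣_) (trans m≡w (*-identityˡ w)) p∣m) p∤w
  helper (suc v) _   = z<s

val>0⇒∣ : ∀ {p} m .{{_ : NonZero m}} → 1 < p → 0 < val p m → p ∣ m
val>0⇒∣ {p} m 1<p v>0 with val-decomposition m 1<p
... | w , m≡ , _ = helper (val p m) v>0 m≡
  where
  helper : ∀ v → 0 < v → m ≡ p ^ v * w → p ∣ m
  helper (suc v) _ m≡ = subst (p ∣_) (sym m≡) (∣m⇒∣m*n w (m∣m*n (p ^ v)))

val-*-indivisible : ∀ {t} a w .{{_ : NonZero w}} → Prime t → ¬ (t ∣ a) →
  val t (a * w) ≡ val t w
val-*-indivisible {t} a w pt t∤a with val-decomposition w (prime>1 pt)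
... | w′ , w≡ , t∤w′ = begin
  val t (a * w)                ≡⟨ cong (val t) a*w≡ ⟩
  val t (t ^ e * (a * w′))     ≡⟨ val-^* e (a * w′) (prime>1 pt) t∤a*w′ ⟩
  e                            ∎
  where
  open ≡-Reasoning
  e : ℕ
  e = val t w
  a*w≡ : a * w ≡ t ^ e * (a * w′)
  a*w≡ = trans (cong (a *_) w≡)
    (solve 3 (λ A T W → A :* (T :* W) := T :* (A :* W)) refl a (t ^ e) w′)
  t∤a*w′ : ¬ (t ∣ a * w′)
  t∤a*w′ t∣ = [ t∤a , t∤w′ ] (euclidsLemma a w′ pt t∣)

-- Exponential divisors

infix 4 _∣ₑ_

_∣ₑ_ : ℕ → ℕ → Set
d ∣ₑ n = d ∣ n × (∀ {t} → Prime t → t ∣ n → val t d ∣ val t n)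

allB⁻ : ∀ f {xs x} → T (allB f xs) → x ∈ xs → T (f x)
allB⁻ f {y ∷ xs} all (here refl) = proj₁ (Equivalence.to (T-∧ {f y}) all)
allB⁻ f {y ∷ xs} all (there x∈) = allB⁻ f (proj₂ (Equivalence.to (T-∧ {f y}) all)) x∈

allB⁺ : ∀ f xs → (∀ x → T (f x)) → T (allB f xs)
allB⁺ f []       _   = _
allB⁺ f (x ∷ xs) all = Equivalence.from (T-∧ {f x}) (all x , allB⁺ f xs all)

eCondition : ℕ → ℕ → ℕ → Bool
eCondition n d t = not (⌊ prime? t ⌋ ∧ ⌊ t ∣? n ⌋) ∨ ⌊ val t d ∣? val t n ⌋

eCondition⁻ : ∀ {n d t} → T (eCondition n d t) →
  Prime t → t ∣ n → val t d ∣ val t n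
eCondition⁻ {n} {d} {t} c pt t∣n with prime? t | t ∣? n
... | no ¬pt | _      = contradiction pt ¬pt
... | yes _  | no t∤n = contradiction t∣n t∤n
... | yes _  | yes _  = toWitness c

eCondition⁺ : ∀ {n d t} → (Prime t → t ∣ n → val t d ∣ val t n) → T (eCondition n d t)
eCondition⁺ {n} {d} {t} val∣ with prime? t | t ∣? n
... | no _   | _       = _
... | yes _  | no _    = _
... | yes pt | yes t∣n = fromWitness (val∣ pt t∣n)

T-isEDiv⁻ : ∀ {n d} .{{_ : NonZero n}} → T (isEDiv n d) → d ∣ₑ n
T-isEDiv⁻ {n} {d} isE = toWitness d∣n? , λ {t} pt t∣n →
  eCondition⁻ {n} {d} (allB⁻ (eCondition n d) all (∈-upTo⁺ (s≤s (∣⇒≤ t∣n)))) pt t∣n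
  where
  d∣n? : T ⌊ d ∣? n ⌋
  d∣n? = proj₁ (Equivalence.to (T-∧ {⌊ d ∣? n ⌋}) isE)
  all  : T (allB (eCondition n d) (upTo (suc n)))
  all  = proj₂ (Equivalence.to (T-∧ {⌊ d ∣? n ⌋}) isE)

T-isEDiv⁺ : ∀ {n d} → d ∣ₑ n → T (isEDiv n d)
T-isEDiv⁺ {n} {d} (d∣n , val∣) = Equivalence.from (T-∧ {⌊ d ∣? n ⌋})
  (fromWitness d∣n ,
   allB⁺ (eCondition n d) (upTo (suc n)) (λ t → eCondition⁺ {n} {d} {t} (λ pt → val∣ pt)))

∈eDivisors⇒nonZero : ∀ {n d} → d ∈ eDivisors n → NonZero d
∈eDivisors⇒nonZero {n} d∈
  with ∈-map⁻ suc (proj₁ (∈-filter⁻ (λ d → T? (isEDiv n d)) {xs = map suc (upTo n)} d∈))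
... | _ , _ , refl = _

∈eDivisors⇔ : ∀ {n d} .{{_ : NonZero n}} → d ∈ eDivisors n ⇔ d ∣ₑ n
∈eDivisors⇔ {n} =
  mk⇔ (λ d∈ → T-isEDiv⁻ (proj₂ (∈-filter⁻ isEDiv? {xs = map suc (upTo n)} d∈))) from
  where
  isEDiv? : Decidable (λ d → T (isEDiv n d))
  isEDiv? d = T? (isEDiv n d)
  from : ∀ {d} → d ∣ₑ n → d ∈ eDivisors n
  from {zero}  (0∣n , _) = contradiction (0∣⇒≡0 0∣n) (≢-nonZero⁻¹ n)
  from {suc d} d∣ₑn      =
    ∈-filter⁺ isEDiv? (∈-map⁺ suc (∈-upTo⁺ (∣⇒≤ (proj₁ d∣ₑn)))) (T-isEDiv⁺ d∣ₑn)

eDivisors-unique : ∀ n → Unique (eDivisors n)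
eDivisors-unique n = filter⁺ (λ d → T? (isEDiv n d)) (map⁺ suc-injective (upTo⁺ n))

n∣ₑn : ∀ n → n ∣ₑ n
n∣ₑn n = ∣-refl , λ _ _ → ∣-refl

∣ₑ⇒radicalDivides : ∀ {n d} .{{_ : NonZero n}} → d ∣ₑ n → RadicalDivides n d
∣ₑ⇒radicalDivides {n} {d} (d∣n , val∣) {t} pt t∣n =
  val>0⇒∣ d {{∣⇒nonZero d∣n}} (prime>1 pt) (n≢0⇒n>0 valₜd≢0)
  where
  valₜd≢0 : val t d ≢ 0
  valₜd≢0 valₜd≡0 = >⇒≢ (∣⇒val>0 n (prime>1 pt) t∣n)
    (0∣⇒≡0 (subst (_∣ val t n) valₜd≡0 (val∣ pt t∣n)))

proper∣ₑ⇒square∣ : ∀ {n d} .{{_ : NonZero n}} → d ∣ₑ n → d ≢ n →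
  ∃ λ r → Prime r × r * r ∣ n
proper∣ₑ⇒square∣ {n} {d} d∣ₑn@(d∣n , _) d≢n
  with ∃primeFactor (quotient>1 d∣n (≤∧≢⇒< (∣⇒≤ d∣n) d≢n))
... | r , pr , r∣k = r , pr , subst (r * r ∣_) (sym (m∣n⇒n≡quotient*m d∣n))
  (*-pres-∣ r∣k (∣ₑ⇒radicalDivides d∣ₑn pr (∣-trans r∣k (quotient-∣ d∣n))))

*-∣ₑ-^* : ∀ {r w} → Prime r → ¬ (r ∣ w) → ∀ j → r * w ∣ₑ r ^ j * (r * w)
*-∣ₑ-^* {r} {w} pr r∤w j = n∣m*n (r ^ j) , valₜ∣
  where
  instance _ = m*n≢0 r w {{prime⇒nonZero pr}} {{∤⇒nonZero r∤w}}
  valₜ∣ : ∀ {t} → Prime t → t ∣ r ^ j * (r * w) → val t (r * w) ∣ val t (r ^ j * (r * w))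
  valₜ∣ {t} pt _ with t ≟ r
  ... | yes refl = subst (_∣ val t (t ^ j * (t * w))) (sym (val-*≡1 w (prime>1 pr) r∤w)) (1∣ _)
  ... | no  t≢r  = ∣-reflexive (sym (val-*-indivisible (r ^ j) (r * w) pt
                     (λ t∣r^j → t≢r (^-onlyPrimeFactor j pr pt t∣r^j))))

-- Products and sums of e-divisors

∈⇒↭∷ : ∀ {A : Set} {x : A} {xs} → x ∈ xs → ∃ λ ys → xs ↭ x ∷ ys
∈⇒↭∷ x∈xs with ys , zs , refl ← ∈-∃++ x∈xs = ys ++ zs , shift _ ys zs

∈-↭-tail : ∀ {A : Set} {xs ys : List A} {x z} → xs ↭ x ∷ ys → z ∈ ys → z ∈ xs
∈-↭-tail π z∈ys = ∈-resp-↭ (↭-sym π) (there z∈ys)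

eDivisors-remove : ∀ {n d} .{{_ : NonZero n}} → d ∣ₑ n →
  ∃ λ ys → eDivisors n ↭ d ∷ ys × All (λ e → e ∣ₑ n × e ≢ d) ys
eDivisors-remove {n} {d} d∣ₑn with ∈⇒↭∷ (Equivalence.from ∈eDivisors⇔ d∣ₑn)
... | ys , π = ys , π , All.tabulate λ e∈ys →
  Equivalence.to ∈eDivisors⇔ (∈-↭-tail π e∈ys) , λ { refl → d∉ys e∈ys }
  where
  d∉ys : d ∉ ys
  d∉ys = Unique[x∷xs]⇒x∉xs (Unique-resp-↭ (↭⇒↭ₛ π) (eDivisors-unique n))

Tₑ-nonZero : ∀ n → NonZero (Tₑ n)
Tₑ-nonZero n = product≢0 (All.tabulate (∈eDivisors⇒nonZero {n}))

Tₑ-split : ∀ n .{{_ : NonZero n}} →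
  ∃ λ ys → Tₑ n ≡ n * product ys × All (λ d → d ∣ₑ n × d ≢ n) ys
Tₑ-split n with eDivisors-remove (n∣ₑn n)
... | ys , π , proper = ys , product-↭ π , proper

Tₑ-split₂ : ∀ {n d} .{{_ : NonZero n}} → d ∣ₑ n → d ≢ n →
  ∃ λ zs → Tₑ n ≡ n * (d * product zs) × All (_∣ₑ n) zs
Tₑ-split₂ {n} {d} d∣ₑn d≢n with eDivisors-remove (n∣ₑn n)
... | ys , π , proper with ∈-resp-↭ π (Equivalence.from ∈eDivisors⇔ d∣ₑn)
...   | here d≡n   = contradiction d≡n d≢n
...   | there d∈ys with ∈⇒↭∷ d∈ys
...     | zs , ρ = zs , trans (product-↭ π) (cong (n *_) (product-↭ ρ)) ,
                   All.tabulate λ z∈zs → proj₁ (All.lookup proper (∈-↭-tail ρ z∈zs))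

square∣⇒decomposition : ∀ {r N} .{{_ : NonZero N}} → Prime r → r * r ∣ N →
  ∃₂ λ k w → N ≡ r ^ suc k * (r * w) × ¬ (r ∣ w)
square∣⇒decomposition {r} {N} pr r²∣N with val-decomposition N (prime>1 pr)
... | w , N≡ , r∤w = helper (val r N) N≡
  where
  instance _ = prime⇒nonZero pr
  helper : ∀ v → N ≡ r ^ v * w → ∃₂ λ k w → N ≡ r ^ suc k * (r * w) × ¬ (r ∣ w)
  helper zero          N≡w  = contradiction
    (subst (r ∣_) (trans N≡w (*-identityˡ w)) (m*n∣⇒m∣ r r r²∣N)) r∤w
  helper (suc zero)    N≡rw = contradiction
    (*-cancelˡ-∣ r (subst (r * r ∣_) (trans N≡rw (cong (_* w) (*-identityʳ r))) r²∣N)) r∤w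
  helper (suc (suc k)) N≡   = k , w , trans N≡ regroup , r∤w
    where
    regroup : r ^ (2 + k) * w ≡ r ^ suc k * (r * w)
    regroup = solve 3 (λ R P W → R :* (R :* P) :* W := R :* P :* (R :* W)) refl r (r ^ k) w

-- N′ = r w is N with the exponent of r lowered to 1.
Tₑ-reduction : ∀ {r N} .{{_ : NonZero N}} → Prime r → r * r ∣ N →
  ∃ λ k → ∃₂ λ N′ zs → N ≡ r ^ suc k * N′ × NonZero N′ ×
    Tₑ N ≡ N * (N′ * product zs) × All (_∣ₑ N) zs
Tₑ-reduction {r} pr r²∣N with square∣⇒decomposition pr r²∣N
... | k , w , refl , r∤w = k , r * w , proj₁ split , refl , N′≢0 , proj₂ split
  where
  instance
    N′≢0 : NonZero (r * w)
    N′≢0 = m*n≢0 r w {{prime⇒nonZero pr}} {{∤⇒nonZero r∤w}}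
  N′≢N : r * w ≢ r ^ suc k * (r * w)
  N′≢N N′≡N = prime∤1 pr (subst (r ∣_) r^k+1≡1 (m∣m*n (r ^ k)))
    where
    r^k+1≡1 : r ^ suc k ≡ 1
    r^k+1≡1 = *-cancelʳ-≡ (r ^ suc k) 1 (r * w) (trans (sym N′≡N) (sym (*-identityˡ (r * w))))
  split : ∃ λ zs → Tₑ (r ^ suc k * (r * w)) ≡ r ^ suc k * (r * w) * (r * w * product zs)
                   × All (_∣ₑ r ^ suc k * (r * w)) zs
  split = Tₑ-split₂ (*-∣ₑ-^* pr r∤w (suc k)) N′≢N

product-∣ₑ : ∀ {n zs} .{{_ : NonZero n}} → All (_∣ₑ n) zs →
  product zs ≡ 1 ⊎ RadicalDivides n (product zs)
product-∣ₑ []         = inj₁ refl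
product-∣ₑ (d∣ₑn ∷ _) = inj₂ λ pt t∣n → ∣m⇒∣m*n _ (∣ₑ⇒radicalDivides d∣ₑn pt t∣n)

radicalDivides-∣-^ : ∀ {n m r j} → RadicalDivides n m → m ∣ r ^ j → Prime r →
  OnlyPrimeFactor r n
radicalDivides-∣-^ {j = j} rad m∣r^j pr pt t∣n =
  ^-onlyPrimeFactor j pr pt (∣-trans (rad pt t∣n) m∣r^j)

-- Multiplicatively e-perfect and e-superperfect numbers

module _ {n} .{{_ : NonTrivial n}} where

  private instance
    n≢0 : NonZero n
    n≢0 = nonTrivial⇒nonZero n

  Tₑ≡sq⇒primePower : Tₑ n ≡ sq n → ∃ λ r → OnlyPrimeFactor r n
  Tₑ≡sq⇒primePower Tₑ≡n² with Tₑ-split n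
  ... | [] , Tₑ≡n*1 , _ =
    contradiction (sym (*-cancelˡ-≡ 1 n n (trans (sym Tₑ≡n*1) Tₑ≡n²))) nonTrivial⇒≢1
  ... | _ ∷ _ , _ , (d∣ₑn , d≢n) ∷ _ with proper∣ₑ⇒square∣ d∣ₑn d≢n
  ...   | r , pr , r²∣n with Tₑ-reduction pr r²∣n
  ...     | k , N′ , zs , n≡ , N′≢0 , Tₑ≡ , zs∣ₑn = r , onlyR
    where
    instance _ = N′≢0
    R : ℕ
    R = product zs
    R≡r^k+1 : R ≡ r ^ suc k
    R≡r^k+1 = *-cancelˡ-≡ R (r ^ suc k) N′ (begin
      N′ * R         ≡⟨ *-cancelˡ-≡ _ _ n (trans (sym Tₑ≡) Tₑ≡n²) ⟩
      n              ≡⟨ n≡ ⟩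
      r ^ suc k * N′ ≡⟨ *-comm (r ^ suc k) N′ ⟩
      N′ * r ^ suc k ∎)
      where open ≡-Reasoning
    onlyR : OnlyPrimeFactor r n
    onlyR with product-∣ₑ zs∣ₑn
    ... | inj₁ R≡1 =
      contradiction (subst (r ∣_) (trans (sym R≡r^k+1) R≡1) (m∣m*n (r ^ k))) (prime∤1 pr)
    ... | inj₂ rad = radicalDivides-∣-^ {j = suc k} rad (∣-reflexive R≡r^k+1) pr

  -- With Tₑ n = n X, every prime factor of n divides X, so q² ∣ Tₑ n; reducing Tₑ n at q
  -- and comparing with Tₑ (Tₑ n) = n² gives X² R = q^(k+1).
  Tₑ∘Tₑ≡sq⇒primePower : Tₑ (Tₑ n) ≡ sq n → ∃ λ r → OnlyPrimeFactor r n
  Tₑ∘Tₑ≡sq⇒primePower TₑTₑ≡n² with Tₑ-split n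
  ... | ys , Tₑ≡n*X , proper with product-∣ₑ (All.map proj₁ proper)
  ...   | inj₁ X≡1 = contradiction (*-cancelˡ-≡ 1 n n (begin
          n * 1        ≡⟨ *-identityʳ n ⟩
          n            ≡⟨ Tₑn≡n ⟨
          Tₑ n         ≡⟨ cong Tₑ Tₑn≡n ⟨
          Tₑ (Tₑ n)    ≡⟨ TₑTₑ≡n² ⟩
          n * n        ∎)) (nonTrivial⇒≢1 ∘ sym)
    where
    open ≡-Reasoning
    Tₑn≡n : Tₑ n ≡ n
    Tₑn≡n = trans Tₑ≡n*X (trans (cong (n *_) X≡1) (*-identityʳ n))
  ...   | inj₂ rad with ∃primeFactor (nonTrivial⇒n>1 n)
  ...     | q , pq , q∣n
    with Tₑ-reduction {{Tₑ-nonZero n}} pq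
           (subst (q * q ∣_) (sym Tₑ≡n*X) (*-pres-∣ q∣n (rad pq q∣n)))
  ...       | k , M′ , zs , Tₑn≡ , M′≢0 , TₑTₑn≡ , _ =
    q , radicalDivides-∣-^ {j = suc k} rad (subst (X ∣_) XXR≡q^k+1 (∣m⇒∣m*n R (m∣m*n X))) pq
    where
    open ≡-Reasoning
    instance _ = M′≢0
    X R : ℕ
    X = product ys
    R = product zs
    n≡XM′R : n ≡ X * (M′ * R)
    n≡XM′R = *-cancelˡ-≡ n _ n (begin
      n * n                ≡⟨ TₑTₑ≡n² ⟨
      Tₑ (Tₑ n)            ≡⟨ TₑTₑn≡ ⟩
      Tₑ n * (M′ * R)      ≡⟨ cong (_* (M′ * R)) Tₑ≡n*X ⟩
      n * X * (M′ * R)     ≡⟨ *-assoc n X (M′ * R) ⟩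
      n * (X * (M′ * R))   ∎)
    XXR≡q^k+1 : X * X * R ≡ q ^ suc k
    XXR≡q^k+1 = *-cancelʳ-≡ _ _ M′ (begin
      X * X * R * M′       ≡⟨ solve 3 (λ X R M → X :* X :* R :* M := X :* (X :* (M :* R)))
                                      refl X R M′ ⟩
      X * (X * (M′ * R))   ≡⟨ cong (X *_) n≡XM′R ⟨
      X * n                ≡⟨ *-comm X n ⟩
      n * X                ≡⟨ Tₑ≡n*X ⟨
      Tₑ n                 ≡⟨ Tₑn≡ ⟩
      q ^ suc k * M′       ∎)

  multPerfect⇒onlyPrimeFactor : ∀ {p} → Tₑ n ≡ sq n ⊎ Tₑ (Tₑ n) ≡ sq n →
    Prime p → p ∣ n → OnlyPrimeFactor p n
  multPerfect⇒onlyPrimeFactor multPerfect pp p∣n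
    with [ Tₑ≡sq⇒primePower , Tₑ∘Tₑ≡sq⇒primePower ]′ multPerfect
  ... | r , onlyR = λ pq q∣n → trans (onlyR pq q∣n) (sym (onlyR pp p∣n))

-- σₑ of a prime power

∣-sum : ∀ {d xs} → All (d ∣_) xs → d ∣ sum xs
∣-sum []            = _ ∣0
∣-sum (d∣x ∷ d∣xs) = ∣m∣n⇒∣m+n d∣x (∣-sum d∣xs)

onlyPrimeFactor⇒square∣ₑ : ∀ {p n d} .{{_ : NonZero n}} → Prime p → p ∣ n →
  OnlyPrimeFactor p n → d ∣ₑ n → d ≢ p → p * p ∣ d
onlyPrimeFactor⇒square∣ₑ {p} {n} {d} pp p∣n only d∣ₑn@(d∣n , _) d≢p =
  subst (p * p ∣_) (sym d≡e*p) (*-monoˡ-∣ p p∣e)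
  where
  p∣d : p ∣ d
  p∣d = ∣ₑ⇒radicalDivides d∣ₑn pp p∣n
  e : ℕ
  e = quotient p∣d
  d≡e*p : d ≡ e * p
  d≡e*p = m∣n⇒n≡quotient*m p∣d
  e≢1 : e ≢ 1
  e≢1 e≡1 = d≢p (trans d≡e*p (trans (cong (_* p) e≡1) (*-identityˡ p)))
  p∣e : p ∣ e
  p∣e = onlyPrimeFactor-∣ only (∣-trans (quotient-∣ p∣d) d∣n) e≢1

σₑ-onlyPrimeFactor : ∀ {p n} .{{_ : NonZero n}} → Prime p → p ∣ n → OnlyPrimeFactor p n →
  ∃ λ c → σₑ n ≡ (1 + c * p) * p
σₑ-onlyPrimeFactor {p} {n} pp p∣n only with eDivisors-remove p∣ₑn
  where
  p∣ₑn : p ∣ₑ n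
  p∣ₑn = p∣n , λ pt t∣n → subst (λ t → val t p ∣ val t n) (sym (only pt t∣n))
    (subst (_∣ val p n) (sym valₚp≡1) (1∣ _))
    where
    valₚp≡1 : val p p ≡ 1
    valₚp≡1 = trans (cong (val p) (sym (*-identityʳ p))) (val-*≡1 1 (prime>1 pp) (prime∤1 pp))
... | ys , π , proper = c , (begin
  σₑ n                ≡⟨ sum-↭ π ⟩
  p + sum ys          ≡⟨ cong (p +_) (m∣n⇒n≡quotient*m p²∣Σys) ⟩
  p + c * (p * p)     ≡⟨ solve 2 (λ P C → P :+ C :* (P :* P) := (con 1 :+ C :* P) :* P) refl p c ⟩
  (1 + c * p) * p     ∎)
  where
  open ≡-Reasoning
  p²∣Σys : p * p ∣ sum ys
  p²∣Σys = ∣-sum (All.map (λ (d∣ₑn , d≢p) →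
    onlyPrimeFactor⇒square∣ₑ pp p∣n only d∣ₑn d≢p) proper)
  c : ℕ
  c = quotient p²∣Σys

∣*⇔/∣ : ∀ {m n p k} .{{_ : NonZero p}} → p ∣ m → p ∣ n → Coprime (m / p) n →
  m ∣ n * k ⇔ m / p ∣ k
∣*⇔/∣ {m} {n} {p} {k} p∣m p∣n coprime = mk⇔
  (λ m∣nk → coprime-divisor coprime (∣-trans (m/n∣m p∣m) m∣nk))
  (λ m/p∣k → ∣-trans (m/n∣o⇒m∣o*n p∣m m/p∣k)
                     (subst (k * p ∣_) (*-comm k n) (*-monoʳ-∣ k p∣n)))

theorem2p2 : (n : ℕ) → 1 < n → (Tₑ n ≡ sq n ⊎ Tₑ (Tₑ n) ≡ sq n) →
    (p : ℕ) → (pr : Prime p) → p ∣ n →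
    ((σₑ n ∣ n * dₑ n → _/_ (σₑ n) p {{prime⇒nonZero pr}} ∣ dₑ n)
      × (_/_ (σₑ n) p {{prime⇒nonZero pr}} ∣ dₑ n → σₑ n ∣ n * dₑ n))
theorem2p2 n 1<n multPerfect p pp p∣n = Equivalence.to harmonic⇔ , Equivalence.from harmonic⇔
  where
  instance
    _ = n>1⇒nonTrivial 1<n
    _ = nonTrivial⇒nonZero n
    _ = prime⇒nonZero pp
  onlyP : OnlyPrimeFactor p n
  onlyP = multPerfect⇒onlyPrimeFactor multPerfect pp p∣n
  c : ℕ
  c = proj₁ (σₑ-onlyPrimeFactor pp p∣n onlyP)
  s : ℕ
  s = 1 + c * p
  σ≡ : σₑ n ≡ s * p
  σ≡ = proj₂ (σₑ-onlyPrimeFactor pp p∣n onlyP)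
  p∣σ : p ∣ σₑ n
  p∣σ = subst (p ∣_) (sym σ≡) (n∣m*n s)
  σ/p≡s : σₑ n / p ≡ s
  σ/p≡s = trans (/-congˡ σ≡) (m*n/n≡m s p)
  p∤s : ¬ (p ∣ s)
  p∤s p∣s = prime∤1 pp (∣m+n∣m⇒∣n (subst (p ∣_) (+-comm 1 (c * p)) p∣s) (n∣m*n c))
  harmonic⇔ : σₑ n ∣ n * dₑ n ⇔ σₑ n / p ∣ dₑ n
  harmonic⇔ = ∣*⇔/∣ p∣σ p∣n
    (onlyPrimeFactor⇒coprime onlyP (subst (λ m → ¬ (p ∣ m)) (sym σ/p≡s) p∤s))
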